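{- Let $P$ be a dealing pattern, $N\ge1$, and let $P'$ be the pattern obtained from $P$ by deleting its first $N$ letters. Then for every $1\le k\le N$, \[J^{P}_{N,k}=\begin{cases} d_k(P), & \text{if } d_k(P)\le N,\\[2pt] u_{m}(P)\ \text{ with } m=J^{P'}_{|P_N|_U,\;k-|P_N|_D}, & \text{otherwise.}\end{cases}\]
   Context: A dealing pattern $P=P_1P_2P_3\cdots$ is an infinite sequence of letters $U$ and $D$ containing infinitely many $D$'s. Dealing a deck of $N$ cards (positions $1,\dots,N$ from the top) by $P$ means: process the letters in order; for a $U$ move the top card to the bottom; for a $D$ remove the top card (deal it); stop when all $N$ cards are dealt. The Josephus triangle is defined by: for $1\le k\le N$, $J^P_{N,k}$ is the initial position of the $k$th card dealt. $d_i(P)$, $u_i(P)$ denote the index (starting from 1) of the $i$th occurrence of $D$, resp. $U$, in $P$. $|P_m|_D$, $|P_m|_U$ denote the number of $D$'s, resp. $U$'s, among the first $m$ letters of $P$. -}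

module Defs where

open import Data.Nat using (ℕ; zero; suc; _+_; _∸_; _≤_; _<_)
open import Data.Nat.Properties using (m+[n∸m]≡n; ≤-trans; m≤m+n; ∸-monoˡ-≤; m+n∸m≡n)
open import Data.List using (List; []; _∷_; _++_; [_]; applyUpTo)
open import Data.Product using (Σ; _×_; _,_; ∃)
open import Relation.Binary.PropositionalEquality using (_≡_; refl; sym; trans; cong; subst)

data Letter : Set where
  U D : Letter

-- A dealing pattern P = P₁P₂P₃⋯ .  Internally 0-based: seq i = P_{i+1}.
-- "Infinitely many D's": beyond every index there is a D.
record Pattern : Set where
  field
    seq  : ℕ → Letter
    infD : ∀ n → Σ ℕ λ m → n ≤ m × seq m ≡ D
open Pattern public

isL : Letter → Letter → ℕ
isL U U = 1
isL D D = 1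
isL U D = 0
isL D U = 0

count : Letter → Pattern → ℕ → ℕ
count c P zero    = 0
count c P (suc m) = count c P m + isL c (seq P m)

countU countD : Pattern → ℕ → ℕ
countU = count U
countD = count D

-- least 0-based index ≥ n carrying a D, by bounded search (fuel = distance
-- to a known D).
searchD : (ℕ → Letter) → ℕ → ℕ → ℕ
searchD s n zero with s n
... | _ = n
searchD s n (suc f) with s n
... | D = n
... | U = searchD s (suc n) f

nextD : Pattern → ℕ → ℕ
nextD P n with infD P n
... | m , _ = searchD (seq P) n (m ∸ n)

-- 0-based index of the (k+1)-th D
posD : Pattern → ℕ → ℕ
posD P zero    = nextD P 0
posD P (suc k) = nextD P (suc (posD P k))

-- d_k(P): 1-based index of the k-th D in P (k ≥ 1; d_0 is a dummy 0).
d : Pattern → ℕ → ℕ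
d P zero    = 0
d P (suc k) = suc (posD P k)

-- i = u_m(P): i is the (1-based) index of the m-th U in P.
IsNthU : Pattern → ℕ → ℕ → Set
IsNthU P m i = Σ ℕ λ j → i ≡ suc j × seq P j ≡ U × countU P i ≡ m

dropP : ℕ → Pattern → Pattern
dropP N P = record { seq = λ i → seq P (N + i) ; infD = inf' }
  where
  inf' : ∀ n → Σ ℕ λ m → n ≤ m × seq P (N + m) ≡ D
  inf' n with infD P (N + n)
  ... | m , le , eq = m ∸ N , le' , trans (cong (seq P) (m+[n∸m]≡n N≤m)) eq
    where
    N≤m : N ≤ m
    N≤m = ≤-trans (m≤m+n N n) le
    le' : n ≤ m ∸ N
    le' = subst (_≤ m ∸ N) (m+n∸m≡n N n) (∸-monoˡ-≤ N le)

-- Dealing simulation: process t letters of the pattern (given as a sequence)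
-- on a deck (list of initial positions, top first); returns the list of dealt
-- cards in dealing order.
run : (ℕ → Letter) → List ℕ → ℕ → List ℕ
run s deck      zero    = []
run s []        (suc t) = []
run s (x ∷ xs)  (suc t) with s 0
... | U = run (λ i → s (suc i)) (xs ++ [ x ]) t
... | D = x ∷ run (λ i → s (suc i)) xs t

-- k-th (1-based) element of a list, 0 as default.
nth : List ℕ → ℕ → ℕ
nth []       _             = 0
nth (x ∷ xs) zero          = 0
nth (x ∷ xs) (suc zero)    = x
nth (x ∷ xs) (suc (suc k)) = nth xs (suc k)

-- Josephus triangle J^P_{N,k}: initial position of the k-th card dealt
-- when dealing the deck 1,…,N by P.  Dealing ends exactly at the N-th D,
-- i.e. after d_N(P) letters, so we simulate that many letters.
J : Pattern → ℕ → ℕ → ℕ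
J P N k = nth (run (seq P) (applyUpTo suc N) (d P N)) k

{-# OPTIONS --safe #-}
module Submission where

-- During the first N letters every card comes to the top exactly once and in
-- its original order: letter i deals card i if P_i = D and moves it to the
-- bottom if P_i = U.  So the cards dealt first are d_1 < d_2 < ⋯ ≤ N, and
-- afterwards the deck holds u_1, …, u_c (c = |P_N|_U) in this order and is
-- dealt by P'.  Dealing only sees positions in the deck, so the card dealt
-- k-th overall is u_m for the position m = J^{P'}_{c, k - |P_N|_D}.

open import Defs
open import Data.Nat using (ℕ; zero; suc; _+_; _∸_; _≤_; _<_; z≤n; s≤s; s≤s⁻¹)
open import Data.Nat.Properties
open import Data.List using (List; []; _∷_; _++_; [_]; applyUpTo; length; map)
open import Data.List.Properties
  using (map-++; ++-assoc; ++-identityʳ; length-++-comm; length-applyUpTo; map-applyUpTo)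
open import Data.List.Relation.Unary.All using (All; []; _∷_)
open import Data.List.Relation.Unary.All.Properties using (++⁺; applyUpTo⁺₁)
open import Data.Product using (Σ; _×_; _,_; proj₁; proj₂; map₂; uncurry)
open import Data.Sum using (_⊎_; inj₁; inj₂)
open import Data.Empty using (⊥-elim)
open import Function using (_∘_)
open import Relation.Nullary using (yes; no)
open import Relation.Binary.PropositionalEquality hiding ([_]; J)
open ≡-Reasoning

Seq : Set
Seq = ℕ → Letter

tail : Seq → Seq
tail s i = s (suc i)

drop : ℕ → Seq → Seq
drop r s i = s (r + i)

deck : ℕ → List ℕ
deck n = applyUpTo suc n

isL-refl : ∀ c → isL c c ≡ 1
isL-refl U = refl
isL-refl D = refl

isL-cases : ∀ c l → l ≡ c ⊎ isL c l ≡ 0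
isL-cases U U = inj₁ refl
isL-cases D D = inj₁ refl
isL-cases U D = inj₂ refl
isL-cases D U = inj₂ refl

-- Unlike `count`, this counts from the front, the way `run` consumes a pattern.
occ : Letter → Seq → ℕ → ℕ
occ c s zero    = 0
occ c s (suc t) = isL c (s 0) + occ c (tail s) t

occ-snoc : ∀ c s t → occ c s (suc t) ≡ occ c s t + isL c (s t)
occ-snoc c s zero    = +-comm (isL c (s 0)) 0
occ-snoc c s (suc t) = begin
  isL c (s 0) + occ c (tail s) (suc t)
    ≡⟨ cong (isL c (s 0) +_) (occ-snoc c (tail s) t) ⟩
  isL c (s 0) + (occ c (tail s) t + isL c (s (suc t)))
    ≡⟨ +-assoc (isL c (s 0)) _ _ ⟨
  occ c s (suc t) + isL c (s (suc t))
    ∎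

count≡occ : ∀ c P t → count c P t ≡ occ c (seq P) t
count≡occ c P zero    = refl
count≡occ c P (suc t) =
  trans (cong (_+ isL c (seq P t)) (count≡occ c P t)) (sym (occ-snoc c (seq P) t))

occ-+ : ∀ c s a b → occ c s (a + b) ≡ occ c s a + occ c (drop a s) b
occ-+ c s zero    b = refl
occ-+ c s (suc a) b =
  trans (cong (isL c (s 0) +_) (occ-+ c (tail s) a b)) (sym (+-assoc (isL c (s 0)) _ _))

occ-mono : ∀ c s {a b} → a ≤ b → occ c s a ≤ occ c s b
occ-mono c s {a} {b} a≤b = subst (occ c s a ≤_) occ-a+[b∸a]≡occ-b (m≤m+n _ _)
  where
  occ-a+[b∸a]≡occ-b : occ c s a + occ c (drop a s) (b ∸ a) ≡ occ c s b
  occ-a+[b∸a]≡occ-b = trans (sym (occ-+ c s a (b ∸ a))) (cong (occ c s) (m+[n∸m]≡n a≤b))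

occD+occU : ∀ s t → occ D s t + occ U s t ≡ t
occD+occU s zero = refl
occD+occU s (suc t) with s 0
... | D = cong suc (occD+occU (tail s) t)
... | U = trans (+-suc (occ D (tail s) t) _) (cong suc (occD+occU (tail s) t))

occ-suc-hit : ∀ c s j → s j ≡ c → occ c s (suc j) ≡ suc (occ c s j)
occ-suc-hit c s j sj≡c rewrite occ-snoc c s j | sj≡c | isL-refl c = +-comm _ 1

occ-suc-miss : ∀ c s j → isL c (s j) ≡ 0 → occ c s (suc j) ≡ occ c s j
occ-suc-miss c s j miss rewrite occ-snoc c s j | miss = +-identityʳ _

occ-hit : ∀ c s r {m} → 1 ≤ m → m ≤ occ c s r →
          Σ ℕ λ j → j < r × s j ≡ c × suc (occ c s j) ≡ m
occ-hit c s zero    1≤m m≤0 = ⊥-elim (<⇒≱ 1≤m m≤0)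
occ-hit c s (suc r) {m} 1≤m m≤ with m ≤? occ c s r | isL-cases c (s r)
... | yes m≤occ | _ with occ-hit c s r 1≤m m≤occ
...   | j , j<r , sj≡c , occj = j , m<n⇒m<1+n j<r , sj≡c , occj
occ-hit c s (suc r) {m} 1≤m m≤ | no m≰occ | inj₁ sr≡c =
  r , n<1+n r , sr≡c , ≤-antisym (≰⇒> m≰occ) (subst (m ≤_) (occ-suc-hit c s r sr≡c) m≤)
occ-hit c s (suc r) {m} 1≤m m≤ | no m≰occ | inj₂ miss =
  ⊥-elim (m≰occ (subst (m ≤_) (occ-suc-miss c s r miss) m≤))

searchD-spec : ∀ s n f → s (n + f) ≡ D →
               s (searchD s n f) ≡ D × occ D s (searchD s n f) ≡ occ D s n
searchD-spec s n zero    sD = subst (λ i → s i ≡ D) (+-identityʳ n) sD , refl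
searchD-spec s n (suc f) sD with s n in sn
... | D = sn , refl
... | U with searchD-spec s (suc n) f (subst (λ i → s i ≡ D) (+-suc n f) sD)
...   | found , occ≡ = found , trans occ≡ (occ-suc-miss D s n (cong (isL D) sn))

nextD-spec : ∀ P n → seq P (nextD P n) ≡ D × occ D (seq P) (nextD P n) ≡ occ D (seq P) n
nextD-spec P n with infD P n
... | m , n≤m , sm =
  searchD-spec (seq P) n (m ∸ n) (subst (λ i → seq P i ≡ D) (sym (m+[n∸m]≡n n≤m)) sm)

occ-d : ∀ P k → occ D (seq P) (d P k) ≡ k

posD-spec : ∀ P k → seq P (posD P k) ≡ D × occ D (seq P) (posD P k) ≡ k
posD-spec P zero = nextD-spec P 0
posD-spec P (suc k) = map₂ (λ occ≡ → trans occ≡ (occ-d P (suc k))) (nextD-spec P (d P (suc k)))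

occ-d P zero    = refl
occ-d P (suc k) =
  trans (occ-suc-hit D (seq P) _ (proj₁ (posD-spec P k))) (cong suc (proj₂ (posD-spec P k)))

k≤d : ∀ P k → k ≤ d P k
k≤d P k = subst (_≤ d P k) (occ-d P k) (subst (occ D (seq P) (d P k) ≤_)
            (occD+occU (seq P) (d P k)) (m≤m+n _ _))

d≤⇒≤occD : ∀ P {k t} → d P k ≤ t → k ≤ occ D (seq P) t
d≤⇒≤occD P {k} dk≤t = subst (_≤ _) (occ-d P k) (occ-mono D (seq P) dk≤t)

<d⇒occD< : ∀ P {k t} → t < d P k → occ D (seq P) t < k
<d⇒occD< P {zero}  ()
<d⇒occD< P {suc k} (s≤s t≤p) =
  s≤s (subst (_ ≤_) (proj₂ (posD-spec P k)) (occ-mono D (seq P) t≤p))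

consWhen : Letter → Letter → ℕ → List ℕ → List ℕ
consWhen U U x xs = x ∷ xs
consWhen D D x xs = x ∷ xs
consWhen U D x xs = xs
consWhen D U x xs = xs

consWhen-hit : ∀ c x xs → consWhen c c x xs ≡ x ∷ xs
consWhen-hit U x xs = refl
consWhen-hit D x xs = refl

length-consWhen : ∀ c l x xs → length (consWhen c l x xs) ≡ isL c l + length xs
length-consWhen U U x xs = refl
length-consWhen D D x xs = refl
length-consWhen U D x xs = refl
length-consWhen D U x xs = refl

select : Letter → Seq → (ℕ → ℕ) → ℕ → List ℕ
select c s f zero    = []
select c s f (suc r) = consWhen c (s 0) (f 0) (select c (tail s) (f ∘ suc) r)

length-select : ∀ c s f r → length (select c s f r) ≡ occ c s r
length-select c s f zero    = refl
length-select c s f (suc r) = trans (length-consWhen c (s 0) (f 0) _)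
  (cong (isL c (s 0) +_) (length-select c (tail s) (f ∘ suc) r))

nth-zero : ∀ xs → nth xs 0 ≡ 0
nth-zero []       = refl
nth-zero (x ∷ xs) = refl

nth-consWhen : ∀ c l x xs o → nth (consWhen c l x xs) (suc (isL c l + o)) ≡ nth xs (suc o)
nth-consWhen U U x xs o = refl
nth-consWhen D D x xs o = refl
nth-consWhen U D x xs o = refl
nth-consWhen D U x xs o = refl

nth-select : ∀ c s f {r j} → j < r → s j ≡ c → nth (select c s f r) (suc (occ c s j)) ≡ f j
nth-select c s f {suc r} {zero} _ s0≡c
  rewrite s0≡c | consWhen-hit c (f 0) (select c (tail s) (f ∘ suc) r) = refl
nth-select c s f {suc r} {suc j} (s≤s j<r) sj≡c =
  trans (nth-consWhen c (s 0) (f 0) _ (occ c (tail s) j)) (nth-select c (tail s) (f ∘ suc) j<r sj≡c)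

nth-++ˡ : ∀ xs ys {k} → k ≤ length xs → nth (xs ++ ys) k ≡ nth xs k
nth-++ˡ []       ys {zero}        _         = nth-zero ys
nth-++ˡ (x ∷ xs) ys {zero}        _         = refl
nth-++ˡ (x ∷ xs) ys {suc zero}    _         = refl
nth-++ˡ (x ∷ xs) ys {suc (suc k)} (s≤s k<) = nth-++ˡ xs ys k<

nth-++ʳ : ∀ xs ys {k} → length xs < k → nth (xs ++ ys) k ≡ nth ys (k ∸ length xs)
nth-++ʳ []       ys _                          = refl
nth-++ʳ (x ∷ xs) ys {suc zero}    (s≤s ())
nth-++ʳ (x ∷ xs) ys {suc (suc k)} (s≤s len<) = nth-++ʳ xs ys len<

nth-map : ∀ g → g 0 ≡ 0 → ∀ xs k → nth (map g xs) k ≡ g (nth xs k)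
nth-map g g0 []       k             = sym g0
nth-map g g0 (x ∷ xs) zero          = sym g0
nth-map g g0 (x ∷ xs) (suc zero)    = refl
nth-map g g0 (x ∷ xs) (suc (suc k)) = nth-map g g0 xs (suc k)

nth-All : ∀ {Q : ℕ → Set} xs {k} → All Q xs → 1 ≤ k → k ≤ length xs → Q (nth xs k)
nth-All (x ∷ xs) {suc zero}    (qx ∷ _)   _ _         = qx
nth-All (x ∷ xs) {suc (suc k)} (_  ∷ qxs) _ (s≤s k<) = nth-All xs qxs (s≤s z≤n) k<

applyUpTo-nth : ∀ xs → applyUpTo (λ i → nth xs (suc i)) (length xs) ≡ xs
applyUpTo-nth []       = refl
applyUpTo-nth (x ∷ xs) = cong (x ∷_) (applyUpTo-nth xs)

map-nth-deck : ∀ xs → map (nth xs) (deck (length xs)) ≡ xs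
map-nth-deck xs = trans (map-applyUpTo suc (nth xs) (length xs)) (applyUpTo-nth xs)

deckAfter : Seq → List ℕ → ℕ → List ℕ
deckAfter s xs       zero    = xs
deckAfter s []       (suc t) = []
deckAfter s (x ∷ xs) (suc t) with s 0
... | U = deckAfter (tail s) (xs ++ [ x ]) t
... | D = deckAfter (tail s) xs t

run-[] : ∀ s t → run s [] t ≡ []
run-[] s zero    = refl
run-[] s (suc t) = refl

run-++ : ∀ s xs a b → run s xs (a + b) ≡ run s xs a ++ run (drop a s) (deckAfter s xs a) b
run-++ s xs       zero    b = refl
run-++ s []       (suc a) b = sym (run-[] _ b)
run-++ s (x ∷ xs) (suc a) b with s 0
... | U = run-++ (tail s) (xs ++ [ x ]) a b
... | D = cong (x ∷_) (run-++ (tail s) xs a b)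

length-run+deckAfter : ∀ s xs t → length (run s xs t) + length (deckAfter s xs t) ≡ length xs
length-run+deckAfter s xs       zero    = refl
length-run+deckAfter s []       (suc t) = refl
length-run+deckAfter s (x ∷ xs) (suc t) with s 0
... | U = trans (length-run+deckAfter (tail s) (xs ++ [ x ]) t) (length-++-comm xs [ x ])
... | D = cong suc (length-run+deckAfter (tail s) xs t)

length-run : ∀ s xs t → occ D s t ≤ length xs → length (run s xs t) ≡ occ D s t
length-run s xs       zero    _ = refl
length-run s []       (suc t) h = sym (n≤0⇒n≡0 h)
length-run s (x ∷ xs) (suc t) h with s 0
... | U = length-run (tail s) (xs ++ [ x ]) t (subst (_ ≤_) (sym (length-++-comm xs [ x ])) h)
... | D = cong suc (length-run (tail s) xs t (s≤s⁻¹ h))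

deckAfter-exhausted : ∀ s xs t → length (run s xs t) ≡ length xs → deckAfter s xs t ≡ []
deckAfter-exhausted s xs t full with deckAfter s xs t | length-run+deckAfter s xs t
... | []     | _   = refl
... | y ∷ ys | len = ⊥-elim (m+1+n≢m _ (trans len (sym full)))

run-exhausted : ∀ s xs {a b} → length (run s xs a) ≡ length xs → a ≤ b →
                run s xs b ≡ run s xs a
run-exhausted s xs {a} {b} full a≤b = begin
  run s xs b
    ≡⟨ cong (run s xs) (m+[n∸m]≡n a≤b) ⟨
  run s xs (a + (b ∸ a))
    ≡⟨ run-++ s xs a (b ∸ a) ⟩
  run s xs a ++ run (drop a s) (deckAfter s xs a) (b ∸ a)
    ≡⟨ cong (λ ys → run s xs a ++ run (drop a s) ys (b ∸ a)) (deckAfter-exhausted s xs a full) ⟩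
  run s xs a ++ run (drop a s) [] (b ∸ a)
    ≡⟨ cong (run s xs a ++_) (run-[] _ (b ∸ a)) ⟩
  run s xs a ++ []
    ≡⟨ ++-identityʳ _ ⟩
  run s xs a
    ∎

complete-runs-agree : ∀ s xs a b → length (run s xs a) ≡ length xs →
                      length (run s xs b) ≡ length xs → run s xs a ≡ run s xs b
complete-runs-agree s xs a b full-a full-b with ≤-total a b
... | inj₁ a≤b = sym (run-exhausted s xs full-a a≤b)
... | inj₂ b≤a = run-exhausted s xs full-b b≤a

run-map : ∀ s g xs t → run s (map g xs) t ≡ map g (run s xs t)
run-map s g xs       zero    = refl
run-map s g []       (suc t) = refl
run-map s g (x ∷ xs) (suc t) with s 0
... | U = trans (cong (λ ys → run (tail s) ys t) (sym (map-++ g xs [ x ])))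
                (run-map (tail s) g (xs ++ [ x ]) t)
... | D = cong (g x ∷_) (run-map (tail s) g xs t)

run-relabel : ∀ s xs t → run s xs t ≡ map (nth xs) (run s (deck (length xs)) t)
run-relabel s xs t = begin
  run s xs t                                     ≡⟨ cong (λ ys → run s ys t) (map-nth-deck xs) ⟨
  run s (map (nth xs) (deck (length xs))) t      ≡⟨ run-map s (nth xs) (deck (length xs)) t ⟩
  map (nth xs) (run s (deck (length xs)) t)      ∎

run-All : ∀ {Q : ℕ → Set} s xs t → All Q xs → All Q (run s xs t)
run-All s xs       zero    _ = []
run-All s []       (suc t) _ = []
run-All s (x ∷ xs) (suc t) (qx ∷ qxs) with s 0
... | U = run-All (tail s) (xs ++ [ x ]) t (++⁺ qxs (qx ∷ []))
... | D = qx ∷ run-All (tail s) xs t qxs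

run-firstPass : ∀ s f r ys → run s (applyUpTo f r ++ ys) r ≡ select D s f r
run-firstPass s f zero    ys = refl
run-firstPass s f (suc r) ys with s 0
... | U = trans (cong (λ zs → run (tail s) zs r) (++-assoc (applyUpTo (f ∘ suc) r) ys [ f 0 ]))
                (run-firstPass (tail s) (f ∘ suc) r (ys ++ [ f 0 ]))
... | D = cong (f 0 ∷_) (run-firstPass (tail s) (f ∘ suc) r ys)

deckAfter-firstPass : ∀ s f r ys → deckAfter s (applyUpTo f r ++ ys) r ≡ ys ++ select U s f r
deckAfter-firstPass s f zero    ys = sym (++-identityʳ ys)
deckAfter-firstPass s f (suc r) ys with s 0
... | U = begin
  deckAfter (tail s) ((applyUpTo (f ∘ suc) r ++ ys) ++ [ f 0 ]) r
    ≡⟨ cong (λ zs → deckAfter (tail s) zs r) (++-assoc (applyUpTo (f ∘ suc) r) ys [ f 0 ]) ⟩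
  deckAfter (tail s) (applyUpTo (f ∘ suc) r ++ ys ++ [ f 0 ]) r
    ≡⟨ deckAfter-firstPass (tail s) (f ∘ suc) r (ys ++ [ f 0 ]) ⟩
  (ys ++ [ f 0 ]) ++ select U (tail s) (f ∘ suc) r
    ≡⟨ ++-assoc ys [ f 0 ] _ ⟩
  ys ++ f 0 ∷ select U (tail s) (f ∘ suc) r
    ∎
... | D = deckAfter-firstPass (tail s) (f ∘ suc) r ys

run-applyUpTo : ∀ s f r t →
  run s (applyUpTo f r) (r + t) ≡ select D s f r ++ run (drop r s) (select U s f r) t
run-applyUpTo s f r t = begin
  run s (applyUpTo f r) (r + t)
    ≡⟨ cong (λ xs → run s xs (r + t)) (++-identityʳ _) ⟨
  run s (applyUpTo f r ++ []) (r + t)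
    ≡⟨ run-++ s _ r t ⟩
  run s (applyUpTo f r ++ []) r ++ run (drop r s) (deckAfter s (applyUpTo f r ++ []) r) t
    ≡⟨ cong₂ (λ xs ys → xs ++ run (drop r s) ys t)
             (run-firstPass s f r []) (deckAfter-firstPass s f r []) ⟩
  select D s f r ++ run (drop r s) (select U s f r) t
    ∎

run-deck-complete : ∀ s N t → occ D s t ≡ N → length (run s (deck N) t) ≡ N
run-deck-complete s N t occ≡N =
  trans (length-run s (deck N) t (≤-reflexive (trans occ≡N (sym (length-applyUpTo suc N)))))
        occ≡N

J-via : ∀ P N k {t} → occ D (seq P) t ≡ N → J P N k ≡ nth (run (seq P) (deck N) t) k
J-via P N k {t} occ≡N = cong (λ xs → nth xs k)
  (complete-runs-agree (seq P) (deck N) (d P N) t (complete (d P N) (occ-d P N)) (complete t occ≡N))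
  where
  complete : ∀ u → occ D (seq P) u ≡ N → length (run (seq P) (deck N) u) ≡ length (deck N)
  complete u occ≡ = trans (run-deck-complete (seq P) N u occ≡) (sym (length-applyUpTo suc N))

J-range : ∀ P N k → 1 ≤ k → k ≤ N → 1 ≤ J P N k × J P N k ≤ N
J-range P N k 1≤k k≤N = nth-All {Q = λ x → 1 ≤ x × x ≤ N} dealt
  (run-All (seq P) (deck N) (d P N) (applyUpTo⁺₁ suc N (λ i<N → s≤s z≤n , i<N)))
  1≤k (subst (k ≤_) (sym (run-deck-complete (seq P) N (d P N) (occ-d P N))) k≤N)
  where
  dealt = run (seq P) (deck N) (d P N)

run-d-split : ∀ P N → run (seq P) (deck N) (d P N) ≡
  select D (seq P) suc N ++ run (seq (dropP N P)) (select U (seq P) suc N) (d P N ∸ N)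
run-d-split P N = trans (cong (run (seq P) (deck N)) (sym (m+[n∸m]≡n (k≤d P N))))
                        (run-applyUpTo (seq P) suc N (d P N ∸ N))

occD-dropP : ∀ P N → occ D (seq (dropP N P)) (d P N ∸ N) ≡ occ U (seq P) N
occD-dropP P N = +-cancelˡ-≡ (occ D s N) _ _ (begin
  occ D s N + occ D (drop N s) (d P N ∸ N)   ≡⟨ occ-+ D s N _ ⟨
  occ D s (N + (d P N ∸ N))                  ≡⟨ cong (occ D s) (m+[n∸m]≡n (k≤d P N)) ⟩
  occ D s (d P N)                            ≡⟨ occ-d P N ⟩
  N                                          ≡⟨ occD+occU s N ⟨
  occ D s N + occ U s N                      ∎)
  where
  s = seq P

nth-select-D : ∀ P {N k} → d P k ≤ N → nth (select D (seq P) suc N) k ≡ d P k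
nth-select-D P {N} {zero}  _     = nth-zero (select D (seq P) suc N)
nth-select-D P {N} {suc k} dk≤N with posD-spec P k
... | sp , occp = trans (cong (λ i → nth (select D (seq P) suc N) (suc i)) (sym occp))
                        (nth-select D (seq P) suc dk≤N sp)

nth-select-U : ∀ P {N m} → 1 ≤ m → m ≤ occ U (seq P) N →
               IsNthU P m (nth (select U (seq P) suc N) m)
nth-select-U P {N} {m} 1≤m m≤ with occ-hit U (seq P) N 1≤m m≤
... | j , j<N , sj , occj = subst (IsNthU P m) (sym nth≡suc-j) (j , refl , sj , countU≡m)
  where
  nth≡suc-j : nth (select U (seq P) suc N) m ≡ suc j
  nth≡suc-j = subst (λ i → nth (select U (seq P) suc N) i ≡ suc j) occj
                    (nth-select U (seq P) suc j<N sj)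
  countU≡m : countU P (suc j) ≡ m
  countU≡m = trans (count≡occ U P (suc j)) (trans (occ-suc-hit U (seq P) j sj) occj)

J-firstPass : ∀ P N {k} → d P k ≤ N → J P N k ≡ d P k
J-firstPass P N {k} dk≤N = begin
  J P N k          ≡⟨ cong (λ xs → nth xs k) (run-d-split P N) ⟩
  nth (LD ++ _) k  ≡⟨ nth-++ˡ LD _ k≤|LD| ⟩
  nth LD k         ≡⟨ nth-select-D P dk≤N ⟩
  d P k            ∎
  where
  LD = select D (seq P) suc N
  k≤|LD| : k ≤ length LD
  k≤|LD| = subst (k ≤_) (sym (length-select D (seq P) suc N)) (d≤⇒≤occD P dk≤N)

J-laterPass : ∀ P N {k} → occ D (seq P) N < k →
  J P N k ≡ nth (select U (seq P) suc N) (J (dropP N P) (occ U (seq P) N) (k ∸ occ D (seq P) N))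
J-laterPass P N {k} cD<k = begin
  J P N k
    ≡⟨ cong (λ xs → nth xs k) (run-d-split P N) ⟩
  nth (LD ++ R) k
    ≡⟨ nth-++ʳ LD R (subst (_< k) (sym lenLD) cD<k) ⟩
  nth R (k ∸ length LD)
    ≡⟨ cong (λ i → nth R (k ∸ i)) lenLD ⟩
  nth R k'
    ≡⟨ cong (λ xs → nth xs k') (run-relabel s' LU F) ⟩
  nth (map (nth LU) (run s' (deck (length LU)) F)) k'
    ≡⟨ nth-map (nth LU) (nth-zero LU) (run s' (deck (length LU)) F) k' ⟩
  nth LU (nth (run s' (deck (length LU)) F) k')
    ≡⟨ cong (λ c → nth LU (nth (run s' (deck c) F) k')) lenLU ⟩
  nth LU (nth (run s' (deck (occ U s N)) F) k')
    ≡⟨ cong (nth LU) (J-via (dropP N P) (occ U s N) k' {F} (occD-dropP P N)) ⟨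
  nth LU (J (dropP N P) (occ U s N) k')
    ∎
  where
  s  = seq P
  s' = seq (dropP N P)
  F  = d P N ∸ N
  LD = select D s suc N
  LU = select U s suc N
  R  = run s' LU F
  k' = k ∸ occ D s N
  lenLD = length-select D s suc N
  lenLU = length-select U s suc N

mainTheorem6 : (P : Pattern) (N : ℕ) → 1 ≤ N → (k : ℕ) → 1 ≤ k → k ≤ N →
    (d P k ≤ N → J P N k ≡ d P k) ×
    (N < d P k → IsNthU P (J (dropP N P) (countU P N) (k ∸ countD P N)) (J P N k))
mainTheorem6 P N _ k _ k≤N = J-firstPass P N , laterPass
  where
  laterPass : N < d P k → IsNthU P (J (dropP N P) (countU P N) (k ∸ countD P N)) (J P N k)
  laterPass N<dk rewrite count≡occ U P N | count≡occ D P N =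
    subst (IsNthU P _) (sym (J-laterPass P N cD<k))
      (uncurry (nth-select-U P {N}) (J-range (dropP N P) c (k ∸ cD) (m<n⇒0<n∸m cD<k) k'≤c))
    where
    cD = occ D (seq P) N
    c  = occ U (seq P) N
    cD<k : cD < k
    cD<k = <d⇒occD< P N<dk
    k'≤c : k ∸ cD ≤ c
    k'≤c = m≤n+o⇒m∸n≤o k cD (subst (k ≤_) (sym (occD+occU (seq P) N)) k≤N)
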